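{- Let $X$ be the Coxeter graph of type $F_n$: a straight line with vertices $s_1,\dots,s_n$, $s_i,s_j$ adjacent iff $|i-j|=1$, $m(s_2,s_3)=4$ and $m(s_i,s_{i+1})=3$ otherwise. Let $w\in W(X)$ be fully commutative. Then $w$ has no reduced expression of the form $\mathbf{x}(s_is_{i+2}s_{i+1})\mathbf{y}(s_{i+1}s_{i+2}s_i)\mathbf{z}$ in which $\mathbf{y}$ has no occurrences of $s_{i+2}$ or $s_{i+3}$.
   Context: An element is fully commutative if any two of its reduced expressions are related by repeatedly swapping adjacent commuting generators. $\mathbf{x},\mathbf{y},\mathbf{z}$ denote words in the generators. -}

module Defs where

open import Data.Nat using (ℕ; zero; suc; _+_; _≤_; _<_)
open import Data.Fin using (Fin; toℕ)
open import Data.List using (List; []; _∷_; _++_; length)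
open import Data.List.Relation.Unary.All using (All)
open import Data.Product using (_×_; Σ; ∃; _,_)
open import Relation.Nullary using (¬_)
open import Relation.Binary.PropositionalEquality using (_≡_; _≢_)
open import Relation.Binary.Construct.Closure.Equivalence using (EqClosure)
open import Relation.Binary.Construct.Closure.ReflexiveTransitive using (Star)

-- Generators s_1,…,s_n of the Coxeter system of type F_n are encoded
-- 0-based as Fin n: the generator s_{k+1} is the element k of Fin n.
Gen : ℕ → Set
Gen n = Fin n

Word : ℕ → Set
Word n = List (Gen n)

-- Coxeter matrix of F_n (0-based indices, for distinct generators):
-- adjacent iff |i-j| = 1; m(s_2,s_3) = 4 (0-based {1,2}); other edges 3;
-- non-adjacent distinct generators commute (m = 2).
data Mᶠ : ℕ → ℕ → ℕ → Set where
  m-23   : Mᶠ 1 2 4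
  m-32   : Mᶠ 2 1 4
  m-up   : ∀ {i} → i ≢ 1 → Mᶠ i (suc i) 3
  m-down : ∀ {i} → i ≢ 1 → Mᶠ (suc i) i 3
  m-far  : ∀ {i j} → suc i < j → Mᶠ i j 2
  m-far' : ∀ {i j} → suc j < i → Mᶠ i j 2

M : ∀ {n} → Gen n → Gen n → ℕ → Set
M s t k = Mᶠ (toℕ s) (toℕ t) k

alt : ∀ {A : Set} → ℕ → A → A → List A
alt zero    a b = []
alt (suc k) a b = a ∷ alt k b a

data Step {n : ℕ} : Word n → Word n → Set where
  cancel : ∀ x y (s : Gen n) → Step (x ++ s ∷ s ∷ y) (x ++ y)
  braid  : ∀ x y (s t : Gen n) k → s ≢ t → M s t k →
           Step (x ++ alt k s t ++ y) (x ++ alt k t s ++ y)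

_≈W_ : ∀ {n} → Word n → Word n → Set
_≈W_ = EqClosure Step

Reduced : ∀ {n} → Word n → Set
Reduced {n} u = ∀ (v : Word n) → v ≈W u → length u ≤ length v

data CommStep {n : ℕ} : Word n → Word n → Set where
  swap : ∀ x y (s t : Gen n) → M s t 2 →
         CommStep (x ++ s ∷ t ∷ y) (x ++ t ∷ s ∷ y)

_≈C_ : ∀ {n} → Word n → Word n → Set
_≈C_ = Star CommStep

FullyCommutative : ∀ {n} → Word n → Set
FullyCommutative {n} w =
  ∀ (u v : Word n) → u ≈W w → v ≈W w → Reduced u → Reduced v → u ≈C v

Avoids : ∀ {n} → ℕ → Gen n → Set
Avoids i g = (toℕ g ≢ i + 2) × (toℕ g ≢ i + 3)

HasBadExpression : ∀ {n} → Word n → Set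
HasBadExpression {n} w =
  Σ ℕ λ i → Σ (Gen n) λ a → Σ (Gen n) λ b → Σ (Gen n) λ c →
  Σ (Word n) λ x → Σ (Word n) λ y → Σ (Word n) λ z →
    toℕ a ≡ i × toℕ b ≡ i + 1 × toℕ c ≡ i + 2 ×
    All (Avoids i) y ×
    let e = x ++ (a ∷ c ∷ b ∷ []) ++ y ++ (b ∷ c ∷ a ∷ []) ++ z in
    Reduced e × e ≈W w

-- A reduced expression of a fully commutative element can never be brought by commutation
-- moves to a word containing a square ss or a braid sts⋯ of length m(s,t) ≥ 3: a square is
-- not reduced, and applying the braid relation gives another reduced expression which is
-- not commutation equivalent, since the projections onto {s,t} differ.  As s_i and s_{i+2}
-- commute, x (s_i s_{i+2} s_{i+1}) y (s_{i+1} s_{i+2} s_i) z is commutation equivalent to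
-- x s_{i+2} (s_i s_{i+1} y s_{i+1} s_i) s_{i+2} z, so it suffices that every word
-- s_i s_{i+1} y s_{i+1} s_i with y free of s_{i+2}, s_{i+3} can be brought to such a shape.
-- This is shown by induction on i, cutting y at occurrences of s_{i+1}, s_i and s_{i-1} and
-- moving letters past those they commute with.  For i ≥ 3 an inner pattern
-- s_{i-1} s_i ⋯ s_i s_{i-1} is handled by the induction hypothesis; i = 1 and i = 2, where
-- m(s_2,s_3) = 4 intervenes, are done by hand.

module Submission where

open import Defs
open import Data.Nat using (ℕ; zero; suc; _+_; _≤_; s≤s; z≤n; _≟_)
open import Data.Nat.Properties
  using ( <-cmp; ≤∧≢⇒<; <-asym; <-irrefl; n<1+n; <⇒≤; <⇒≱; m≤n+m; 1+n≰n; n≤1+n; ≤-refl; ≤-trans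
        ; +-cancelˡ-≤; suc-injective; +-comm)
open import Data.Fin using (toℕ; suc; inject₁)
open import Data.Fin.Properties using (toℕ-injective; toℕ-inject₁) renaming (_≟_ to _≟ᶠ_)
open import Data.List using ([]; _∷_; [_]; _++_; length; filter)
open import Data.List.Properties
  using (++-assoc; length-++; ++-cancelˡ; ∷-injectiveˡ; filter-++; filter-all; filter-accept; filter-reject)
open import Data.List.Relation.Unary.All using (All; []; _∷_)
import Data.List.Relation.Unary.All as All
open import Data.List.Relation.Unary.All.Properties using (++⁺; ++⁻ˡ; ++⁻ʳ)
open import Data.Product using (_×_; ∃; _,_)
open import Data.Sum using (_⊎_; inj₁; inj₂)
open import Data.Empty using (⊥; ⊥-elim)
open import Function using (_∘′_)
open import Relation.Nullary using (¬_; Dec; yes; no; contradiction)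
open import Relation.Nullary.Decidable using (_⊎-dec_)
open import Relation.Unary using (Decidable)
open import Relation.Binary.PropositionalEquality
  using (_≡_; _≢_; refl; sym; trans; cong; subst; subst₂; module ≡-Reasoning)
open import Relation.Binary.Definitions using (tri<; tri≈; tri>)
open import Relation.Binary.Construct.Closure.ReflexiveTransitive using (ε; _◅_; _◅◅_; gmap; reverse)
import Relation.Binary.Construct.Closure.ReflexiveTransitive as Star
open import Relation.Binary.Construct.Closure.Symmetric using (fwd; bwd)
import Relation.Binary.Construct.Closure.Equivalence as EqClosure

private
  variable
    n i j k l : ℕ
    a b s t g h : Gen n
    p q r u v x y : Word n

length-alt : ∀ {A : Set} k (a b : A) → length (alt k a b) ≡ k
length-alt zero    a b = refl
length-alt (suc k) a b = cong suc (length-alt k b a)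

alt-All : ∀ {A : Set} {P : A → Set} {a b} k → P a → P b → All P (alt k a b)
alt-All zero    pa pb = []
alt-All (suc k) pa pb = pa ∷ alt-All k pb pa

alt-head-≡ : ∀ {A : Set} {a b : A} {y z} → 1 ≤ k → alt k a b ++ y ≡ alt k b a ++ z → a ≡ b
alt-head-≡ {k = suc _} _ eq = ∷-injectiveˡ eq

filter-swap : ∀ {A : Set} {P : A → Set} (P? : Decidable P) {g h : A} ys →
              ¬ (P g × P h) → filter P? (g ∷ h ∷ ys) ≡ filter P? (h ∷ g ∷ ys)
filter-swap {P = P} P? {g} {h} ys ¬both = by-cases (P? g) (P? h)
  where
  by-cases : Dec (P g) → Dec (P h) → filter P? (g ∷ h ∷ ys) ≡ filter P? (h ∷ g ∷ ys)
  by-cases (yes Pg) (yes Ph) = ⊥-elim (¬both (Pg , Ph))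
  by-cases (yes Pg) (no ¬Ph) =
    trans (filter-accept P? Pg) (trans (cong (g ∷_) (filter-reject P? ¬Ph))
      (sym (trans (filter-reject P? ¬Ph) (filter-accept P? Pg))))
  by-cases (no ¬Pg) (yes Ph) =
    trans (filter-reject P? ¬Pg) (trans (filter-accept P? Ph)
      (sym (trans (filter-accept P? Ph) (cong (h ∷_) (filter-reject P? ¬Pg)))))
  by-cases (no ¬Pg) (no ¬Ph) =
    trans (filter-reject P? ¬Pg) (trans (filter-reject P? ¬Ph)
      (sym (trans (filter-reject P? ¬Ph) (filter-reject P? ¬Pg))))

All-after : ∀ {A : Set} {P : A → Set} p {g : A} {q} → All P (p ++ g ∷ q) → All P q
All-after p = All.tail ∘′ ++⁻ʳ p

Mᶠ-sym₂ : Mᶠ i j 2 → Mᶠ j i 2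
Mᶠ-sym₂ (m-far i<j) = m-far' i<j
Mᶠ-sym₂ (m-far' j<i) = m-far j<i

Mᶠ-irrefl : ¬ Mᶠ i i k
Mᶠ-irrefl (m-far 1+i<i) = <-asym 1+i<i (n<1+n _)
Mᶠ-irrefl (m-far' 1+i<i) = <-asym 1+i<i (n<1+n _)

Mᶠ-functional : Mᶠ i j k → Mᶠ i j l → k ≡ l
Mᶠ-functional m-23 m-23 = refl
Mᶠ-functional m-32 m-32 = refl
Mᶠ-functional (m-up _) (m-up _) = refl
Mᶠ-functional (m-down _) (m-down _) = refl
Mᶠ-functional (m-far _) (m-far _) = refl
Mᶠ-functional (m-far' _) (m-far' _) = refl
Mᶠ-functional m-23 (m-up 1≢1) = ⊥-elim (1≢1 refl)
Mᶠ-functional (m-up 1≢1) m-23 = ⊥-elim (1≢1 refl)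
Mᶠ-functional m-32 (m-down 1≢1) = ⊥-elim (1≢1 refl)
Mᶠ-functional (m-down 1≢1) m-32 = ⊥-elim (1≢1 refl)
Mᶠ-functional m-23 (m-far (s≤s (s≤s ())))
Mᶠ-functional (m-far (s≤s (s≤s ()))) m-23
Mᶠ-functional m-32 (m-far' (s≤s (s≤s ())))
Mᶠ-functional m-23 (m-far' (s≤s ()))
Mᶠ-functional (m-far' (s≤s ())) m-23
Mᶠ-functional m-32 (m-far (s≤s ()))
Mᶠ-functional (m-far (s≤s ())) m-32
Mᶠ-functional (m-far' (s≤s (s≤s ()))) m-32
Mᶠ-functional (m-up _) (m-far 1+i<1+i) = ⊥-elim (<-irrefl refl 1+i<1+i)
Mᶠ-functional (m-far 1+i<1+i) (m-up _) = ⊥-elim (<-irrefl refl 1+i<1+i)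
Mᶠ-functional (m-down _) (m-far' 1+i<1+i) = ⊥-elim (<-irrefl refl 1+i<1+i)
Mᶠ-functional (m-far' 1+i<1+i) (m-down _) = ⊥-elim (<-irrefl refl 1+i<1+i)
Mᶠ-functional (m-up _) (m-far' 2+i<i) = ⊥-elim (<⇒≱ 2+i<i (m≤n+m _ 2))
Mᶠ-functional (m-far' 2+i<i) (m-up _) = ⊥-elim (<⇒≱ 2+i<i (m≤n+m _ 2))
Mᶠ-functional (m-down _) (m-far 2+i<i) = ⊥-elim (<⇒≱ 2+i<i (m≤n+m _ 2))
Mᶠ-functional (m-far 2+i<i) (m-down _) = ⊥-elim (<⇒≱ 2+i<i (m≤n+m _ 2))
Mᶠ-functional (m-far i<j) (m-far' j<i) = ⊥-elim (<-asym (<⇒≤ i<j) (<⇒≤ j<i))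
Mᶠ-functional (m-far' j<i) (m-far i<j) = ⊥-elim (<-asym (<⇒≤ i<j) (<⇒≤ j<i))

distant⇒Mᶠ₂ : ∀ {i j} → i ≢ j → i ≢ suc j → j ≢ suc i → Mᶠ i j 2
distant⇒Mᶠ₂ {i} {j} i≢j i≢1+j j≢1+i with <-cmp i j
... | tri< i<j _ _ = m-far (≤∧≢⇒< i<j (λ 1+i≡j → j≢1+i (sym 1+i≡j)))
... | tri≈ _ i≡j _ = ⊥-elim (i≢j i≡j)
... | tri> _ _ j<i = m-far' (≤∧≢⇒< j<i (λ 1+j≡i → i≢1+j (sym 1+j≡i)))

infix 4 _≉_
_≉_ : Gen n → ℕ → Set
g ≉ i = toℕ g ≢ i

Commutes : Gen n → Gen n → Set
Commutes s g = M g s 2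

M⇒≢ : M s t k → s ≢ t
M⇒≢ m refl = Mᶠ-irrefl m

commuting-not-braid : M s t k → 3 ≤ k → ¬ M s t 2
commuting-not-braid m 3≤k m₂ with Mᶠ-functional m m₂
... | refl with 3≤k
...   | s≤s (s≤s ())

CommStep⇒Step : CommStep u v → Step u v
CommStep⇒Step (swap x y s t m) = braid x y s t 2 (M⇒≢ m) m

CommStep-sym : CommStep u v → CommStep v u
CommStep-sym (swap x y s t m) = swap x y t s (Mᶠ-sym₂ m)

CommStep-++ˡ : ∀ x → CommStep u v → CommStep (x ++ u) (x ++ v)
CommStep-++ˡ x (swap y z s t m) =
  subst₂ CommStep (++-assoc x y (s ∷ t ∷ z)) (++-assoc x y (t ∷ s ∷ z)) (swap (x ++ y) z s t m)

≈C-sym : u ≈C v → v ≈C u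
≈C-sym = reverse CommStep-sym

≈C-++ˡ : ∀ x → u ≈C v → (x ++ u) ≈C (x ++ v)
≈C-++ˡ x = gmap (x ++_) (CommStep-++ˡ x)

≈C⇒≈W : u ≈C v → u ≈W v
≈C⇒≈W = Star.map (fwd ∘′ CommStep⇒Step)

≈W-sym : u ≈W v → v ≈W u
≈W-sym = EqClosure.symmetric Step

≈C-length : u ≈C v → length u ≡ length v
≈C-length ε = refl
≈C-length (swap x y s t m ◅ steps) = trans (trans (length-++ x) (sym (length-++ x))) (≈C-length steps)

commute-right : All (Commutes s) p → (s ∷ p ++ r) ≈C (p ++ s ∷ r)
commute-right [] = ε
commute-right {s = s} {p = g ∷ p} {r = r} (g⇆s ∷ p⇆s) =
  swap [] (p ++ r) s g (Mᶠ-sym₂ g⇆s) ◅ ≈C-++ˡ [ g ] (commute-right p⇆s)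

commute-left : All (Commutes s) p → (p ++ s ∷ r) ≈C (s ∷ p ++ r)
commute-left p⇆s = ≈C-sym (commute-right p⇆s)

data Obstruction {n : ℕ} : Word n → Set where
  square : ∀ (x y : Word n) s → Obstruction (x ++ s ∷ s ∷ y)
  braid  : ∀ (x y : Word n) s t {k} → M s t k → 3 ≤ k → Obstruction (x ++ alt k s t ++ y)

Obstructed : Word n → Set
Obstructed u = ∃ λ v → u ≈C v × Obstruction v

Obstruction-++ˡ : ∀ x → Obstruction u → Obstruction (x ++ u)
Obstruction-++ˡ x (square y z s) =
  subst Obstruction (++-assoc x y (s ∷ s ∷ z)) (square (x ++ y) z s)
Obstruction-++ˡ x (braid y z s t {k} m 3≤k) =
  subst Obstruction (++-assoc x y (alt k s t ++ z)) (braid (x ++ y) z s t m 3≤k)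

Obstructed-++ˡ : ∀ x → Obstructed u → Obstructed (x ++ u)
Obstructed-++ˡ x (v , u≈v , obstruction) = x ++ v , ≈C-++ˡ x u≈v , Obstruction-++ˡ x obstruction

Obstructed-≈C : u ≈C v → Obstructed v → Obstructed u
Obstructed-≈C u≈v (w , v≈w , obstruction) = w , u≈v ◅◅ v≈w , obstruction

square-across : All (Commutes s) p → Obstructed (s ∷ p ++ s ∷ r)
square-across {s = s} {p = p} {r = r} p⇆s = p ++ s ∷ s ∷ r , commute-right p⇆s , square p r s

braid-across : M s t 3 → All (Commutes s) p → All (Commutes s) q →
               Obstructed (s ∷ p ++ t ∷ q ++ s ∷ r)
braid-across {s = s} {t} {p = p} {q} {r} m p⇆s q⇆s =
  p ++ s ∷ t ∷ s ∷ q ++ r ,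
  commute-right p⇆s ◅◅ ≈C-++ˡ p (≈C-++ˡ (s ∷ t ∷ []) (commute-left q⇆s)) ,
  braid p (q ++ r) s t m ≤-refl

braid₄-across : M s t 4 → All (Commutes s) p → All (Commutes t) p → All (Commutes t) q →
                Obstructed (s ∷ t ∷ p ++ s ∷ q ++ t ∷ r)
braid₄-across {s = s} {t} {p = p} {q} {r} m p⇆s p⇆t q⇆t =
  s ∷ t ∷ s ∷ t ∷ p ++ q ++ r ,
  ≈C-++ˡ (s ∷ t ∷ [])
    (≈C-++ˡ p (≈C-++ˡ [ s ] (commute-left q⇆t)) ◅◅ commute-left p⇆s ◅◅ ≈C-++ˡ [ s ] (commute-left p⇆t)) ,
  braid [] (p ++ q ++ r) s t m (n≤1+n 3)

length-braid : ∀ x y (s t : Gen n) → length (x ++ alt k s t ++ y) ≡ length (x ++ alt k t s ++ y)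
length-braid {k = k} x y s t = begin
  length (x ++ alt k s t ++ y)               ≡⟨ length-++ x ⟩
  length x + length (alt k s t ++ y)         ≡⟨ cong (length x +_) (length-++ (alt k s t)) ⟩
  length x + (length (alt k s t) + length y) ≡⟨ cong (λ ℓ → length x + (ℓ + length y)) alt-lengths ⟩
  length x + (length (alt k t s) + length y) ≡⟨ cong (length x +_) (length-++ (alt k t s)) ⟨
  length x + length (alt k t s ++ y)         ≡⟨ length-++ x ⟨
  length (x ++ alt k t s ++ y)               ∎
  where
  open ≡-Reasoning
  alt-lengths : length (alt k s t) ≡ length (alt k t s)
  alt-lengths = trans (length-alt k s t) (sym (length-alt k t s))

Reduced-resp : u ≈W v → length u ≡ length v → Reduced u → Reduced v
Reduced-resp u≈v |u|≡|v| red w w≈v = subst (_≤ length w) |u|≡|v| (red w (w≈v ◅◅ ≈W-sym u≈v))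

Reduced-resp-≈C : u ≈C v → Reduced u → Reduced v
Reduced-resp-≈C u≈v = Reduced-resp (≈C⇒≈W u≈v) (≈C-length u≈v)

square-not-reduced : ¬ Reduced (x ++ s ∷ s ∷ y)
square-not-reduced {x = x} {s} {y} red =
  1+n≰n (<⇒≤ (+-cancelˡ-≤ (length x) _ _ (subst₂ _≤_ (length-++ x) (length-++ x) longer≤shorter)))
  where
  longer≤shorter : length (x ++ s ∷ s ∷ y) ≤ length (x ++ y)
  longer≤shorter = red (x ++ y) (bwd (cancel x y s) ◅ ε)

-- Commutation moves never exchange s and t, so they preserve the subword on {s,t};
-- the two sides of a braid in s and t have different such subwords.
module Projection {n : ℕ} (s t : Gen n) {k : ℕ} (s-t : M s t k) (3≤k : 3 ≤ k) where

  OnPair : Gen n → Set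
  OnPair g = g ≡ s ⊎ g ≡ t

  onPair? : Decidable OnPair
  onPair? g = (g ≟ᶠ s) ⊎-dec (g ≟ᶠ t)

  project : Word n → Word n
  project = filter onPair?

  not-both-on-pair : M g h 2 → OnPair g → OnPair h → ⊥
  not-both-on-pair g-h (inj₁ refl) (inj₁ refl) = Mᶠ-irrefl g-h
  not-both-on-pair g-h (inj₁ refl) (inj₂ refl) = commuting-not-braid s-t 3≤k g-h
  not-both-on-pair g-h (inj₂ refl) (inj₁ refl) = commuting-not-braid s-t 3≤k (Mᶠ-sym₂ g-h)
  not-both-on-pair g-h (inj₂ refl) (inj₂ refl) = Mᶠ-irrefl g-h

  project-swap : M g h 2 → project (g ∷ h ∷ y) ≡ project (h ∷ g ∷ y)
  project-swap {y = y} g-h = filter-swap onPair? y λ (g∈ , h∈) → not-both-on-pair g-h g∈ h∈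

  project-CommStep : CommStep u v → project u ≡ project v
  project-CommStep (swap x y g h g-h) = begin
    project (x ++ g ∷ h ∷ y)           ≡⟨ filter-++ onPair? x _ ⟩
    project x ++ project (g ∷ h ∷ y)   ≡⟨ cong (project x ++_) (project-swap g-h) ⟩
    project x ++ project (h ∷ g ∷ y)   ≡⟨ filter-++ onPair? x _ ⟨
    project (x ++ h ∷ g ∷ y)           ∎
    where open ≡-Reasoning

  project-≈C : u ≈C v → project u ≡ project v
  project-≈C ε = refl
  project-≈C (step ◅ steps) = trans (project-CommStep step) (project-≈C steps)

  project-braid : ∀ x y {a b} → OnPair a → OnPair b →
                  project (x ++ alt k a b ++ y) ≡ project x ++ alt k a b ++ project y
  project-braid x y {a} {b} a∈ b∈ = begin
    project (x ++ alt k a b ++ y)                 ≡⟨ filter-++ onPair? x _ ⟩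
    project x ++ project (alt k a b ++ y)         ≡⟨ cong (project x ++_) (filter-++ onPair? (alt k a b) y) ⟩
    project x ++ project (alt k a b) ++ project y ≡⟨ cong (λ w → project x ++ w ++ project y) alt-kept ⟩
    project x ++ alt k a b ++ project y           ∎
    where
    open ≡-Reasoning
    alt-kept : project (alt k a b) ≡ alt k a b
    alt-kept = filter-all onPair? (alt-All k a∈ b∈)

  braid-not-≈C : ∀ x y → ¬ ((x ++ alt k s t ++ y) ≈C (x ++ alt k t s ++ y))
  braid-not-≈C x y braid≈C =
    M⇒≢ s-t (alt-head-≡ (≤-trans (s≤s z≤n) 3≤k) (++-cancelˡ (project x) _ _ projections-agree))
    where
    projections-agree : project x ++ alt k s t ++ project y ≡ project x ++ alt k t s ++ project y
    projections-agree = trans (sym (project-braid x y (inj₁ refl) (inj₂ refl)))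
                          (trans (project-≈C braid≈C) (project-braid x y (inj₂ refl) (inj₁ refl)))

FC-reduced⇒¬Obstructed : ∀ {w : Word n} → FullyCommutative w → Reduced u → u ≈W w → ¬ Obstructed u
FC-reduced⇒¬Obstructed fc red u≈w (_ , u≈v , square x y s) =
  square-not-reduced (Reduced-resp-≈C u≈v red)
FC-reduced⇒¬Obstructed fc red u≈w (_ , u≈v , braid x y s t {k} s-t 3≤k) =
  Projection.braid-not-≈C s t s-t 3≤k x y (fc _ _ v≈w v′≈w red-v red-v′)
  where
  red-v : Reduced (x ++ alt k s t ++ y)
  red-v = Reduced-resp-≈C u≈v red
  v≈w : (x ++ alt k s t ++ y) ≈W _
  v≈w = ≈W-sym (≈C⇒≈W u≈v) ◅◅ u≈w
  v≈v′ : (x ++ alt k s t ++ y) ≈W (x ++ alt k t s ++ y)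
  v≈v′ = fwd (braid x y s t k (M⇒≢ s-t) s-t) ◅ ε
  v′≈w : (x ++ alt k t s ++ y) ≈W _
  v′≈w = ≈W-sym v≈v′ ◅◅ v≈w
  red-v′ : Reduced (x ++ alt k t s ++ y)
  red-v′ = Reduced-resp v≈v′ (length-braid x y s t) red-v

data FirstSplit {n : ℕ} (s : Gen n) (i : ℕ) : Word n → Set where
  absent : All (_≉ i) u → FirstSplit s i u
  first  : ∀ p q → All (_≉ i) p → FirstSplit s i (p ++ s ∷ q)

firstSplit : toℕ s ≡ i → ∀ u → FirstSplit s i u
firstSplit s≡i [] = absent []
firstSplit {i = i} s≡i (g ∷ u) with toℕ g ≟ i
... | yes g≡i rewrite toℕ-injective (trans g≡i (sym s≡i)) = first [] u []
... | no g≉i with firstSplit s≡i u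
...   | absent u≉i    = absent (g≉i ∷ u≉i)
...   | first p q p≉i = first (g ∷ p) q (g≉i ∷ p≉i)

data LastSplit {n : ℕ} (s : Gen n) (i : ℕ) : Word n → Set where
  absent : All (_≉ i) u → LastSplit s i u
  last   : ∀ p q → All (_≉ i) q → LastSplit s i (p ++ s ∷ q)

lastSplit : toℕ s ≡ i → ∀ u → LastSplit s i u
lastSplit s≡i [] = absent []
lastSplit {i = i} s≡i (g ∷ u) with lastSplit s≡i u
... | last p q q≉i = last (g ∷ p) q q≉i
... | absent u≉i with toℕ g ≟ i
...   | yes g≡i rewrite toℕ-injective (trans g≡i (sym s≡i)) = last [] u u≉i
...   | no g≉i = absent (g≉i ∷ u≉i)

data Blocks {n : ℕ} (s : Gen n) (i : ℕ) : Word n → Set where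
  final : All (_≉ i) u → Blocks s i u
  block : ∀ p → All (_≉ i) p → Blocks s i q → Blocks s i (p ++ s ∷ q)

blocks : toℕ s ≡ i → ∀ u → Blocks s i u
blocks s≡i [] = final []
blocks {i = i} s≡i (g ∷ u) with toℕ g ≟ i | blocks s≡i u
... | yes g≡i | u-blocks rewrite toℕ-injective (trans g≡i (sym s≡i)) = block [] [] u-blocks
... | no g≉i  | final u≉i          = final (g≉i ∷ u≉i)
... | no g≉i  | block p p≉i blocks′ = block (g ∷ p) (g≉i ∷ p≉i) blocks′

M-at : toℕ s ≡ i → toℕ t ≡ j → Mᶠ i j k → M s t k
M-at refl refl m = m

predecessor : ∀ (s : Gen n) → toℕ s ≡ suc i → ∃ λ (r : Gen n) → toℕ r ≡ i
predecessor (suc s) s≡1+i = inject₁ s , trans (toℕ-inject₁ s) (suc-injective s≡1+i)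

commutes : toℕ s ≡ suc i →
           All (_≉ i) p → All (_≉ suc i) p → All (_≉ suc (suc i)) p → All (Commutes s) p
commutes s≡1+i [] [] [] = []
commutes s≡1+i (g≉i ∷ p≉i) (g≉1+i ∷ p≉1+i) (g≉2+i ∷ p≉2+i) =
  M-at refl s≡1+i (distant⇒Mᶠ₂ g≉1+i g≉2+i (λ 1+i≡1+g → g≉i (sym (suc-injective 1+i≡1+g))))
  ∷ commutes s≡1+i p≉i p≉1+i p≉2+i

commutes₀ : toℕ s ≡ 0 → All (_≉ 0) p → All (_≉ 1) p → All (Commutes s) p
commutes₀ s≡0 [] [] = []
commutes₀ s≡0 (g≉0 ∷ p≉0) (g≉1 ∷ p≉1) =
  M-at refl s≡0 (distant⇒Mᶠ₂ g≉0 g≉1 λ ()) ∷ commutes₀ s≡0 p≉0 p≉1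

-- a and b are s_{j+1} and s_{j+2}, so y avoids s_{j+3} and s_{j+4}.
ObstructedAt : ℕ → Set
ObstructedAt j = ∀ {n} {a b : Gen n} → toℕ a ≡ j → toℕ b ≡ suc j → ∀ y z →
                 All (_≉ 2 + j) y → All (_≉ 3 + j) y → Obstructed (a ∷ b ∷ y ++ b ∷ a ∷ z)

-- s and t are s₁ and s₂, and the only neighbour of s₂ that u may contain is s₁.  According as
-- u contains no, one, or at least two s₁'s, one gets s₂ s₂, s₂ s₁ s₂, or s₁ s₁ (the only
-- neighbour of s₁ being s₂).
s₂⋯s₂-obstructed : ∀ {s t : Gen n} → toℕ s ≡ 0 → toℕ t ≡ 1 →
                   All (_≉ 1) u → All (_≉ 2) u → Obstructed (t ∷ u ++ t ∷ r)
s₂⋯s₂-obstructed {u = u} {r = r} {s} {t} s≡0 t≡1 u≉1 u≉2 with firstSplit s≡0 u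
... | absent u≉0 = square-across (commutes t≡1 u≉0 u≉1 u≉2)
... | first p q p≉0 rewrite ++-assoc p (s ∷ q) (t ∷ r) with firstSplit s≡0 q
...   | absent q≉0 =
        braid-across (M-at t≡1 s≡0 (m-down λ ()))
          (commutes t≡1 p≉0 (++⁻ˡ p u≉1) (++⁻ˡ p u≉2))
          (commutes t≡1 q≉0 (All-after p u≉1) (All-after p u≉2))
...   | first p′ q′ p′≉0 rewrite ++-assoc p′ (s ∷ q′) (t ∷ r) =
        Obstructed-++ˡ (t ∷ p) (square-across (commutes₀ s≡0 p′≉0 (++⁻ˡ p′ (All-after p u≉1))))

obstructed-at-0 : ObstructedAt 0
obstructed-at-0 {a = a} {b} a≡0 b≡1 y z y≉2 _ with firstSplit b≡1 y
... | absent y≉1 = Obstructed-++ˡ [ a ] (s₂⋯s₂-obstructed a≡0 b≡1 y≉1 y≉2)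
... | first u v u≉1 rewrite ++-assoc u (b ∷ v) (b ∷ a ∷ z) =
        Obstructed-++ˡ [ a ] (s₂⋯s₂-obstructed a≡0 b≡1 u≉1 (++⁻ˡ u y≉2))

module ObstructedAtOne {n : ℕ} {d a b : Gen n}
                       (d≡0 : toℕ d ≡ 0) (a≡1 : toℕ a ≡ 1) (b≡2 : toℕ b ≡ 2) where

  d-a : M d a 3
  d-a = M-at d≡0 a≡1 (m-up λ ())

  b⋯d⋯a⋯b⋯a-obstructed′ : ∀ p₁ {p₂ q r r′ : Word n} →
    All (Commutes b) p₁ → All (Commutes b) p₂ → All (_≉ 0) p₂ → All (_≉ 1) p₂ →
    All (_≉ 0) q → All (_≉ 1) q → All (_≉ 2) q → All (_≉ 3) q → All (_≉ 1) r → All (_≉ 3) r →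
    Obstructed (b ∷ p₁ ++ d ∷ p₂ ++ a ∷ q ++ b ∷ r ++ a ∷ r′)
  b⋯d⋯a⋯b⋯a-obstructed′ p₁ {p₂} {q} {r} {r′} p₁⇆b p₂⇆b p₂≉0 p₂≉1 q≉0 q≉1 q≉2 q≉3 r≉1 r≉3
    with firstSplit b≡2 r
  ... | first s₁ s₂ s₁≉2 rewrite ++-assoc s₁ (b ∷ s₂) (a ∷ r′) =
        Obstructed-++ˡ (b ∷ p₁) (Obstructed-++ˡ (d ∷ p₂) (Obstructed-++ˡ (a ∷ q)
          (square-across (commutes b≡2 (++⁻ˡ s₁ r≉1) s₁≉2 (++⁻ˡ s₁ r≉3)))))
  ... | absent r≉2 with firstSplit d≡0 r
  ...   | first s₁ s₂ s₁≉0
          rewrite ++-assoc s₁ (d ∷ s₂) (a ∷ r′) | sym (++-assoc q (b ∷ s₁) (d ∷ s₂ ++ a ∷ r′)) =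
          Obstructed-++ˡ (b ∷ p₁) (braid-across d-a (commutes₀ d≡0 p₂≉0 p₂≉1)
            (++⁺ (commutes₀ d≡0 q≉0 q≉1) (d⇆b ∷ commutes₀ d≡0 s₁≉0 (++⁻ˡ s₁ r≉1))))
    where
    d⇆b : Commutes d b
    d⇆b = M-at b≡2 d≡0 (m-far' (s≤s (s≤s z≤n)))
  ...   | absent r≉0 rewrite sym (++-assoc p₁ (d ∷ p₂) (a ∷ q ++ b ∷ r ++ a ∷ r′)) =
          Obstructed-≈C (commute-right (++⁺ p₁⇆b (b⇆d ∷ p₂⇆b)))
            (Obstructed-++ˡ (p₁ ++ d ∷ p₂) (braid₄-across (M-at b≡2 a≡1 m-32)
              (commutes b≡2 q≉1 q≉2 q≉3) (commutes a≡1 q≉0 q≉1 q≉2) (commutes a≡1 r≉0 r≉1 r≉2)))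
    where
    b⇆d : Commutes b d
    b⇆d = M-at d≡0 b≡2 (m-far (s≤s (s≤s z≤n)))

  b⋯d⋯a⋯b⋯a-obstructed : ∀ p₁ {p₂ q r r′ : Word n} →
    All (Commutes b) p₁ → All (Commutes b) p₂ → All (_≉ 0) p₂ → All (_≉ 1) p₂ →
    All (_≉ 1) q → All (_≉ 2) q → All (_≉ 3) q → All (_≉ 1) r → All (_≉ 3) r →
    Obstructed (b ∷ p₁ ++ d ∷ p₂ ++ a ∷ q ++ b ∷ r ++ a ∷ r′)
  b⋯d⋯a⋯b⋯a-obstructed p₁ {q = q} {r} {r′} p₁⇆b p₂⇆b p₂≉0 p₂≉1 q≉1 q≉2 q≉3 r≉1 r≉3
    with firstSplit d≡0 q
  ... | absent q≉0 =
        b⋯d⋯a⋯b⋯a-obstructed′ p₁ p₁⇆b p₂⇆b p₂≉0 p₂≉1 q≉0 q≉1 q≉2 q≉3 r≉1 r≉3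
  ... | first q₁ q₂ q₁≉0 rewrite ++-assoc q₁ (d ∷ q₂) (b ∷ r ++ a ∷ r′) =
        Obstructed-++ˡ (b ∷ p₁)
          (braid-across d-a (commutes₀ d≡0 p₂≉0 p₂≉1) (commutes₀ d≡0 q₁≉0 (++⁻ˡ q₁ q≉1)))

  ab⋯a⋯b⋯a-obstructed : ∀ p {q r r′ : Word n} →
    All (_≉ 1) p → All (_≉ 2) p → All (_≉ 3) p → All (_≉ 2) q → All (_≉ 3) q →
    All (_≉ 1) r → All (_≉ 3) r → Obstructed (a ∷ b ∷ p ++ a ∷ q ++ b ∷ r ++ a ∷ r′)
  ab⋯a⋯b⋯a-obstructed p {q} {r} {r′} p≉1 p≉2 p≉3 q≉2 q≉3 r≉1 r≉3 with firstSplit a≡1 q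
  ... | first m q′ m≉1 rewrite ++-assoc m (a ∷ q′) (b ∷ r ++ a ∷ r′) =
        Obstructed-++ˡ (a ∷ b ∷ p) (s₂⋯s₂-obstructed d≡0 a≡1 m≉1 (++⁻ˡ m q≉2))
  ... | absent q≉1 with lastSplit d≡0 p
  ...   | absent p≉0 =
          braid₄-across (M-at a≡1 b≡2 m-23)
            (commutes a≡1 p≉0 p≉1 p≉2) (commutes b≡2 p≉1 p≉2 p≉3) (commutes b≡2 q≉1 q≉2 q≉3)
  ...   | last p₁ p₂ p₂≉0 rewrite ++-assoc p₁ (d ∷ p₂) (a ∷ q ++ b ∷ r ++ a ∷ r′) =
          Obstructed-++ˡ [ a ] (b⋯d⋯a⋯b⋯a-obstructed p₁
            (commutes b≡2 (++⁻ˡ p₁ p≉1) (++⁻ˡ p₁ p≉2) (++⁻ˡ p₁ p≉3))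
            (commutes b≡2 (All-after p₁ p≉1) (All-after p₁ p≉2) (All-after p₁ p≉3))
            p₂≉0 (All-after p₁ p≉1) q≉1 q≉2 q≉3 r≉1 r≉3)

  ab⋯b⋯a-obstructed : ∀ u {r r′ : Word n} →
    All (_≉ 2) u → All (_≉ 3) u → All (_≉ 1) r → All (_≉ 3) r → Obstructed (a ∷ b ∷ u ++ b ∷ r ++ a ∷ r′)
  ab⋯b⋯a-obstructed u {r} {r′} u≉2 u≉3 r≉1 r≉3 with firstSplit a≡1 u
  ... | absent u≉1 = Obstructed-++ˡ [ a ] (square-across (commutes b≡2 u≉1 u≉2 u≉3))
  ... | first p q p≉1 rewrite ++-assoc p (a ∷ q) (b ∷ r ++ a ∷ r′) =
        ab⋯a⋯b⋯a-obstructed p p≉1 (++⁻ˡ p u≉2) (++⁻ˡ p u≉3)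
          (All-after p u≉2) (All-after p u≉3) r≉1 r≉3

  ab⋯ba-obstructed : ∀ y (z : Word n) → All (_≉ 3) y → Obstructed (a ∷ b ∷ y ++ b ∷ a ∷ z)
  ab⋯ba-obstructed y z y≉3 with firstSplit b≡2 y
  ... | absent y≉2 = ab⋯b⋯a-obstructed y y≉2 y≉3 [] []
  ... | first u v u≉2 rewrite ++-assoc u (b ∷ v) (b ∷ a ∷ z) with firstSplit a≡1 v
  ...   | first v₁ v₂ v₁≉1 rewrite ++-assoc v₁ (a ∷ v₂) (b ∷ a ∷ z) =
          ab⋯b⋯a-obstructed u u≉2 (++⁻ˡ u y≉3) v₁≉1 (++⁻ˡ v₁ (All-after u y≉3))
  ...   | absent v≉1 rewrite sym (++-assoc v [ b ] (a ∷ z)) =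
          ab⋯b⋯a-obstructed u u≉2 (++⁻ˡ u y≉3)
            (++⁺ v≉1 ((λ b≡1 → contradiction (trans (sym b≡2) b≡1) λ ()) ∷ []))
            (++⁺ (All-after u y≉3) ((λ b≡3 → contradiction (trans (sym b≡2) b≡3) λ ()) ∷ []))

obstructed-at-1 : ObstructedAt 1
obstructed-at-1 {a = a} a≡1 b≡2 y z y≉3 _ with predecessor a a≡1
... | d , d≡0 = ObstructedAtOne.ab⋯ba-obstructed d≡0 a≡1 b≡2 y z y≉3

module ObstructedAtStep {j : ℕ} (obstructed-below : ObstructedAt (1 + j))
                        {n : ℕ} {d a b : Gen n}
                        (d≡1+j : toℕ d ≡ 1 + j) (a≡2+j : toℕ a ≡ 2 + j) (b≡3+j : toℕ b ≡ 3 + j) where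

  a-b : M a b 3
  a-b = M-at a≡2+j b≡3+j (m-up λ ())

  -- If no d follows the second a before b, that a moves up to b and the pattern a b r takes
  -- over; otherwise the two a's lie inside d ⋯ a ⋯ a ⋯ d, the pattern one level down.
  d⋯a⋯a⋯b-obstructed : ∀ p m {q r : Word n} → Obstructed (a ∷ b ∷ r) →
    All (_≉ 1 + j) p → All (_≉ 2 + j) p → All (_≉ 3 + j) p → All (_≉ 4 + j) p →
    All (_≉ 3 + j) m → All (_≉ 4 + j) m → All (_≉ 2 + j) q → All (_≉ 3 + j) q → All (_≉ 4 + j) q →
    Obstructed (d ∷ p ++ a ∷ m ++ a ∷ q ++ b ∷ r)
  d⋯a⋯a⋯b-obstructed p m {q} {r} abr p≉1 p≉2 p≉3 p≉4 m≉3 m≉4 q≉2 q≉3 q≉4 with firstSplit d≡1+j q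
  ... | absent q≉1 =
        Obstructed-++ˡ (d ∷ p) (Obstructed-++ˡ (a ∷ m)
          (Obstructed-≈C (commute-right (commutes a≡2+j q≉1 q≉2 q≉3)) (Obstructed-++ˡ q abr)))
  ... | first q₁ q₂ q₁≉1 rewrite ++-assoc q₁ (d ∷ q₂) (b ∷ r) =
        Obstructed-≈C
          (≈C-++ˡ [ d ] (commute-left (commutes a≡2+j p≉1 p≉2 p≉3)
            ◅◅ ≈C-++ˡ (a ∷ p) (≈C-++ˡ m (commute-right q₁⇆a))))
          (subst Obstructed (cong (λ w → d ∷ a ∷ w) reassociate)
            (obstructed-below d≡1+j a≡2+j (p ++ m ++ q₁) (q₂ ++ b ∷ r)
              (++⁺ p≉3 (++⁺ m≉3 (++⁻ˡ q₁ q≉3))) (++⁺ p≉4 (++⁺ m≉4 (++⁻ˡ q₁ q≉4)))))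
    where
    q₁⇆a : All (Commutes a) q₁
    q₁⇆a = commutes a≡2+j q₁≉1 (++⁻ˡ q₁ q≉2) (++⁻ˡ q₁ q≉3)
    reassociate : (p ++ m ++ q₁) ++ a ∷ d ∷ q₂ ++ b ∷ r ≡ p ++ m ++ q₁ ++ a ∷ d ∷ q₂ ++ b ∷ r
    reassociate = trans (++-assoc p (m ++ q₁) _) (cong (p ++_) (++-assoc m q₁ _))

  ab⋯a⋯a⋯b-obstructed : ∀ p m {q r : Word n} → Obstructed (a ∷ b ∷ r) →
    All (_≉ 2 + j) p → All (_≉ 3 + j) p → All (_≉ 4 + j) p →
    All (_≉ 3 + j) m → All (_≉ 4 + j) m → All (_≉ 2 + j) q → All (_≉ 3 + j) q → All (_≉ 4 + j) q →
    Obstructed (a ∷ b ∷ p ++ a ∷ m ++ a ∷ q ++ b ∷ r)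
  ab⋯a⋯a⋯b-obstructed p m {q} {r} abr p≉2 p≉3 p≉4 m≉3 m≉4 q≉2 q≉3 q≉4 with lastSplit d≡1+j p
  ... | absent p≉1 = braid-across a-b [] (commutes a≡2+j p≉1 p≉2 p≉3)
  ... | last p₁ p₂ p₂≉1 rewrite ++-assoc p₁ (d ∷ p₂) (a ∷ m ++ a ∷ q ++ b ∷ r) =
        Obstructed-++ˡ (a ∷ b ∷ p₁) (d⋯a⋯a⋯b-obstructed p₂ m abr
          p₂≉1 (All-after p₁ p≉2) (All-after p₁ p≉3) (All-after p₁ p≉4) m≉3 m≉4 q≉2 q≉3 q≉4)

  ab⋯a⋯b-obstructed : ∀ p q {r : Word n} → Obstructed (a ∷ b ∷ r) →
    All (_≉ 2 + j) p → All (_≉ 3 + j) p → All (_≉ 4 + j) p → All (_≉ 3 + j) q → All (_≉ 4 + j) q →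
    Obstructed (a ∷ b ∷ p ++ a ∷ q ++ b ∷ r)
  ab⋯a⋯b-obstructed p q {r} abr p≉2 p≉3 p≉4 q≉3 q≉4 with lastSplit a≡2+j q
  ... | absent q≉2 =
        Obstructed-++ˡ [ a ] (braid-across (M-at b≡3+j a≡2+j (m-down λ ()))
          (commutes b≡3+j p≉2 p≉3 p≉4) (commutes b≡3+j q≉2 q≉3 q≉4))
  ... | last m q′ q′≉2 rewrite ++-assoc m (a ∷ q′) (b ∷ r) =
        ab⋯a⋯a⋯b-obstructed p m abr p≉2 p≉3 p≉4
          (++⁻ˡ m q≉3) (++⁻ˡ m q≉4) q′≉2 (All-after m q≉3) (All-after m q≉4)

  ab⋯b-obstructed : ∀ u {r : Word n} → Obstructed (a ∷ b ∷ r) →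
    All (_≉ 3 + j) u → All (_≉ 4 + j) u → Obstructed (a ∷ b ∷ u ++ b ∷ r)
  ab⋯b-obstructed u {r} abr u≉3 u≉4 with firstSplit a≡2+j u
  ... | absent u≉2 = Obstructed-++ˡ [ a ] (square-across (commutes b≡3+j u≉2 u≉3 u≉4))
  ... | first p q p≉2 rewrite ++-assoc p (a ∷ q) (b ∷ r) =
        ab⋯a⋯b-obstructed p q abr p≉2 (++⁻ˡ p u≉3) (++⁻ˡ p u≉4)
          (All-after p u≉3) (All-after p u≉4)

  ab⋯ba-obstructed : ∀ {y} (z : Word n) → Blocks b (3 + j) y → All (_≉ 4 + j) y →
    Obstructed (a ∷ b ∷ y ++ b ∷ a ∷ z)
  ab⋯ba-obstructed z (final y≉3) y≉4 =
    ab⋯b-obstructed _ (_ , ε , braid [] z a b a-b ≤-refl) y≉3 y≉4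
  ab⋯ba-obstructed z (block {q = v} u u≉3 v-blocks) y≉4 rewrite ++-assoc u (b ∷ v) (b ∷ a ∷ z) =
    ab⋯b-obstructed u (ab⋯ba-obstructed z v-blocks (All-after u y≉4)) u≉3 (++⁻ˡ u y≉4)

obstructed-at-suc : ObstructedAt (1 + j) → ObstructedAt (2 + j)
obstructed-at-suc obstructed-below {a = a} a≡2+j b≡3+j y z y≉4 _ with predecessor a a≡2+j
... | d , d≡1+j =
  ObstructedAtStep.ab⋯ba-obstructed obstructed-below d≡1+j a≡2+j b≡3+j z (blocks b≡3+j y) y≉4

obstructed-at : ∀ j → ObstructedAt j
obstructed-at zero          = obstructed-at-0
obstructed-at (suc zero)    = obstructed-at-1
obstructed-at (suc (suc j)) = obstructed-at-suc (obstructed-at (suc j))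

lemma4p3p4 : (n : ℕ) (w : Word n) → FullyCommutative w → ¬ HasBadExpression w
lemma4p3p4 n w fc (i , a , b , c , x , y , z , a≡i , b≡i+1 , c≡i+2 , y-avoids , reduced , e≈w) =
  FC-reduced⇒¬Obstructed fc reduced e≈w
    (Obstructed-++ˡ x (Obstructed-≈C a-c-swaps (Obstructed-++ˡ [ c ]
      (obstructed-at i a≡i (trans b≡i+1 (+-comm i 1)) y (c ∷ z)
        (All.map (λ (g≉i+2 , _) g≡2+i → g≉i+2 (trans g≡2+i (+-comm 2 i))) y-avoids)
        (All.map (λ (_ , g≉i+3) g≡3+i → g≉i+3 (trans g≡3+i (+-comm 3 i))) y-avoids)))))
  where
  a-c : M a c 2
  a-c = M-at a≡i (trans c≡i+2 (+-comm i 2)) (m-far ≤-refl)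
  a-c-swaps : (a ∷ c ∷ b ∷ y ++ b ∷ c ∷ a ∷ z) ≈C (c ∷ a ∷ b ∷ y ++ b ∷ a ∷ c ∷ z)
  a-c-swaps = swap [] _ a c a-c ◅ ≈C-++ˡ (c ∷ a ∷ b ∷ y) (≈C-++ˡ [ b ] (swap [] z c a (Mᶠ-sym₂ a-c) ◅ ε))
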